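{- Let $\mathcal{D}\subseteq\mathbb{N}$ with $0\in\mathcal{D}$, let $f\colon\{2\}\cup\mathcal{D}\to\mathbb{N}$, let $k\le n$, and suppose $E_1,E_2\colon\binom{[2n]}{k}\to\{0,1\}^m$ is a two-player $f$-code. Then for all $x,y\in\binom{[2n]}{k}$, \[\max\big\{\mathrm{dist}(E_1(x),E_2(y)),\ \mathrm{dist}(E_1(x),E_1(y)),\ \mathrm{dist}(E_2(x),E_2(y))\big\}\le 2f(0)+\tfrac{f(2)}{2}\,\mathrm{dist}(x,y).\]
   Context: $\binom{[2n]}{k}$ is the set of strings in $\{0,1\}^{2n}$ of Hamming weight $k$, and $\mathrm{dist}$ is Hamming distance. A pair $E_1,E_2\colon\mathcal{X}\to\{0,1\}^m$ is a two-player $f$-code if $\mathrm{dist}(E_1(x),E_2(y))=f(\mathrm{dist}(x,y))$ for all $x,y\in\mathcal{X}$ with $\mathrm{dist}(x,y)$ in the domain of $f$. -}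

module Defs where

open import Data.Bool using (Bool; true; false)
open import Data.Nat using (ℕ; zero; suc; _+_)
open import Data.Vec using (Vec; []; _∷_)
open import Data.Product using (Σ; proj₁)
open import Data.Sum using (_⊎_)
open import Relation.Binary.PropositionalEquality using (_≡_)
open import Relation.Nullary using (¬_)

weight : ∀ {n} → Vec Bool n → ℕ
weight [] = 0
weight (true ∷ v) = suc (weight v)
weight (false ∷ v) = weight v

dist : ∀ {n} → Vec Bool n → Vec Bool n → ℕ
dist [] [] = 0
dist (a ∷ u) (b ∷ v) with a Data.Bool.≟ b
... | Relation.Nullary.yes _ = dist u v
... | Relation.Nullary.no _ = suc (dist u v)

-- the slice ([N] choose k): strings of length N with Hamming weight k
Slice : ℕ → ℕ → Set
Slice N k = Σ (Vec Bool N) (λ x → weight x ≡ k)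

IsTwoPlayerCode : ∀ {N k m} → (Dom : ℕ → Set) → (f : ℕ → ℕ)
  → (E₁ E₂ : Slice N k → Vec Bool m) → Set
IsTwoPlayerCode {N} {k} Dom f E₁ E₂ =
  (x y : Slice N k) → Dom (dist (proj₁ x) (proj₁ y)) →
  dist (E₁ x) (E₂ y) ≡ f (dist (proj₁ x) (proj₁ y))

{-# OPTIONS --safe #-}
-- Two strings x ≠ y of the same weight can be brought 2 closer by switching off a 1 of x
-- where y has a 0 and switching on a 0 of x where y has a 1, so x and y are joined inside
-- the slice by δ(x,y)/2 such steps. Walking along them while alternating between E₁ and E₂
-- costs f(2) per step, and the endpoint contributes dist(E_b y, E_b′ y) ∈ {0, f(0)}; the
-- triangle inequality then gives 2 dist(E_b x, E_b′ y) ≤ 2 f(0) + f(2) δ(x,y).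
module Submission where

open import Data.Bool using (Bool; true; false; not)
open import Data.Nat using (ℕ; suc; _+_; _*_; _≤_; _<_; _⊔_; z≤n; s≤s; _≟_)
open import Data.Nat.Induction using (<-wellFounded)
open import Data.Nat.Properties
open import Algebra.Properties.CommutativeSemigroup +-commutativeSemigroup
  using () renaming (interchange to +-interchange)
open import Data.Nat.Tactic.RingSolver using (solve-∀)
open import Data.Product using (_,_; proj₁; proj₂)
open import Data.Sum using (_⊎_; inj₁; inj₂)
open import Data.Vec using (Vec; []; _∷_; [_])
open import Induction.WellFounded using (Acc; acc)
open import Relation.Binary.PropositionalEquality using (_≡_; refl; sym; trans; cong; cong₂)
open import Relation.Nullary using (yes; no)

open import Defs

dist-∷ : ∀ {N} a b (u v : Vec Bool N) → dist (a ∷ u) (b ∷ v) ≡ dist [ a ] [ b ] + dist u v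
dist-∷ true  true  u v = refl
dist-∷ true  false u v = refl
dist-∷ false true  u v = refl
dist-∷ false false u v = refl

dist-self : ∀ {N} (u : Vec Bool N) → dist u u ≡ 0
dist-self []          = refl
dist-self (true ∷ u)  = dist-self u
dist-self (false ∷ u) = dist-self u

dist≡0⇒≡ : ∀ {N} {u v : Vec Bool N} → dist u v ≡ 0 → u ≡ v
dist≡0⇒≡ {u = []}          {[]}        _ = refl
dist≡0⇒≡ {u = true ∷ u}  {true ∷ v}  e = cong (true ∷_) (dist≡0⇒≡ e)
dist≡0⇒≡ {u = false ∷ u} {false ∷ v} e = cong (false ∷_) (dist≡0⇒≡ e)

dist-sym : ∀ {N} (u v : Vec Bool N) → dist u v ≡ dist v u
dist-sym []          []          = refl
dist-sym (true ∷ u)  (true ∷ v)  = dist-sym u v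
dist-sym (true ∷ u)  (false ∷ v) = cong suc (dist-sym u v)
dist-sym (false ∷ u) (true ∷ v)  = cong suc (dist-sym u v)
dist-sym (false ∷ u) (false ∷ v) = dist-sym u v

bit-dist-triangle : ∀ a b c → dist [ a ] [ c ] ≤ dist [ a ] [ b ] + dist [ b ] [ c ]
bit-dist-triangle true  _     true  = z≤n
bit-dist-triangle false _     false = z≤n
bit-dist-triangle true  true  false = ≤-refl
bit-dist-triangle true  false false = ≤-refl
bit-dist-triangle false true  true  = ≤-refl
bit-dist-triangle false false true  = ≤-refl

dist-triangle : ∀ {N} (u v w : Vec Bool N) → dist u w ≤ dist u v + dist v w
dist-triangle []      []      []      = z≤n
dist-triangle (a ∷ u) (b ∷ v) (c ∷ w) = begin
  dist (a ∷ u) (c ∷ w)                                ≡⟨ dist-∷ a c u w ⟩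
  dist [ a ] [ c ] + dist u w                         ≤⟨ +-mono-≤ (bit-dist-triangle a b c) (dist-triangle u v w) ⟩
  (dist [ a ] [ b ] + dist [ b ] [ c ]) + (dist u v + dist v w)
    ≡⟨ +-interchange (dist [ a ] [ b ]) _ _ _ ⟩
  (dist [ a ] [ b ] + dist u v) + (dist [ b ] [ c ] + dist v w)
    ≡⟨ sym (cong₂ _+_ (dist-∷ a b u v) (dist-∷ b c v w)) ⟩
  dist (a ∷ u) (b ∷ v) + dist (b ∷ v) (c ∷ w)         ∎
  where open ≤-Reasoning

record GeodesicStep {N} (x y : Vec Bool N) (d w : ℕ) : Set where
  constructor step
  field
    point        : Vec Bool N
    weight-point : weight point ≡ w
    dist-point   : dist x point ≡ d
    dist-rest    : dist x y ≡ d + dist point y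

open GeodesicStep

lower-step : ∀ {N w} (x y : Vec Bool N) → weight x ≡ suc w → weight y ≤ w → GeodesicStep x y 1 w
lower-step (true ∷ x)  (false ∷ y) e       _       = step (false ∷ x) (suc-injective e) (cong suc (dist-self x)) refl
lower-step (true ∷ x)  (true ∷ y)  e       (s≤s p) =
  let step z wz dz r = lower-step x y (suc-injective e) p in step (true ∷ z) (cong suc wz) dz r
lower-step (false ∷ x) (false ∷ y) e       p       =
  let step z wz dz r = lower-step x y e p in step (false ∷ z) wz dz r
lower-step (false ∷ x) (true ∷ y)  e       p       =
  let step z wz dz r = lower-step x y e (<⇒≤ p) in step (false ∷ z) wz dz (cong suc r)

raise-step : ∀ {N} (x y : Vec Bool N) → weight x < weight y → GeodesicStep x y 1 (suc (weight x))
raise-step (false ∷ x) (true ∷ y)  _       = step (true ∷ x) refl (cong suc (dist-self x)) refl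
raise-step (true ∷ x)  (true ∷ y)  (s≤s p) =
  let step z wz dz r = raise-step x y p in step (true ∷ z) (cong suc wz) dz r
raise-step (false ∷ x) (false ∷ y) p       =
  let step z wz dz r = raise-step x y p in step (false ∷ z) wz dz r
raise-step (true ∷ x)  (false ∷ y) p       =
  let step z wz dz r = raise-step x y (<⇒≤ p) in step (true ∷ z) (cong suc wz) dz (cong suc r)

swap-step : ∀ {N} (x y : Vec Bool N) → weight x ≡ weight y → 0 < dist x y → GeodesicStep x y 2 (weight x)
swap-step []          []          _ ()
swap-step (true ∷ x)  (true ∷ y)  e p =
  let step z wz dz r = swap-step x y (suc-injective e) p in step (true ∷ z) (cong suc wz) dz r
swap-step (false ∷ x) (false ∷ y) e p =
  let step z wz dz r = swap-step x y e p in step (false ∷ z) wz dz r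
swap-step (true ∷ x)  (false ∷ y) e _ =
  let step z wz dz r = raise-step x y (≤-reflexive e) in step (false ∷ z) wz (cong suc dz) (cong suc r)
swap-step (false ∷ x) (true ∷ y)  e _ =
  let step z wz dz r = lower-step x y e ≤-refl in step (true ∷ z) (trans (cong suc wz) (sym e)) (cong suc dz) (cong suc r)

Slice-≡ : ∀ {N k} {x y : Slice N k} → proj₁ x ≡ proj₁ y → x ≡ y
Slice-≡ {x = u , p} {.u , q} refl = cong (u ,_) (≡-irrelevant p q)

module TwoPlayerCode {N k m} {Dom : ℕ → Set} {f : ℕ → ℕ} {E₁ E₂ : Slice N k → Vec Bool m}
                     (code : IsTwoPlayerCode Dom f E₁ E₂) (dom₀ : Dom 0) (dom₂ : Dom 2) where

  E : Bool → Slice N k → Vec Bool m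
  E true  = E₁
  E false = E₂

  δ : Slice N k → Slice N k → ℕ
  δ x y = dist (proj₁ x) (proj₁ y)

  dist-E-not : ∀ {d} b x y → δ x y ≡ d → Dom d → dist (E b x) (E (not b) y) ≡ f d
  dist-E-not true  x y refl dom = code x y dom
  dist-E-not false x y e    dom with refl ← trans (dist-sym (proj₁ y) (proj₁ x)) e =
    trans (dist-sym (E₂ x) (E₁ y)) (code y x dom)

  dist-E-same : ∀ b x y → δ x y ≡ 0 → dist (E b x) (E b y) ≡ 0
  dist-E-same b x y e with refl ← Slice-≡ {x = x} {y} (dist≡0⇒≡ e) = dist-self (E b x)

  dist-E-coincident : ∀ b b' x y → δ x y ≡ 0 → dist (E b x) (E b' y) ≤ f 0
  dist-E-coincident true  true  x y e = ≤-trans (≤-reflexive (dist-E-same true x y e)) z≤n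
  dist-E-coincident false false x y e = ≤-trans (≤-reflexive (dist-E-same false x y e)) z≤n
  dist-E-coincident true  false x y e = ≤-reflexive (dist-E-not true x y e dom₀)
  dist-E-coincident false true  x y e = ≤-reflexive (dist-E-not false x y e dom₀)

  dist-E-bound-acc : ∀ b b' x y → Acc _<_ (δ x y) → 2 * dist (E b x) (E b' y) ≤ 2 * f 0 + f 2 * δ x y
  dist-E-bound-acc b b' x y (acc rs) with δ x y ≟ 0
  ... | yes e  = ≤-trans (*-monoʳ-≤ 2 (dist-E-coincident b b' x y e)) (m≤m+n (2 * f 0) (f 2 * δ x y))
  ... | no δ≢0 = begin
    2 * dist (E b x) (E b' y)
      ≤⟨ *-monoʳ-≤ 2 (dist-triangle (E b x) (E (not b) z) (E b' y)) ⟩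
    2 * (dist (E b x) (E (not b) z) + dist (E (not b) z) (E b' y))
      ≡⟨ cong (λ t → 2 * (t + dist (E (not b) z) (E b' y))) (dist-E-not b x z (dist-point s) dom₂) ⟩
    2 * (f 2 + dist (E (not b) z) (E b' y))
      ≡⟨ *-distribˡ-+ 2 (f 2) _ ⟩
    2 * f 2 + 2 * dist (E (not b) z) (E b' y)
      ≤⟨ +-monoʳ-≤ (2 * f 2) (dist-E-bound-acc (not b) b' z y (rs δzy<δxy)) ⟩
    2 * f 2 + (2 * f 0 + f 2 * δ z y)
      ≡⟨ regroup (f 0) (f 2) (δ z y) ⟩
    2 * f 0 + f 2 * (2 + δ z y)
      ≡⟨ cong (λ t → 2 * f 0 + f 2 * t) (sym (dist-rest s)) ⟩
    2 * f 0 + f 2 * δ x y ∎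
    where
    open ≤-Reasoning
    s : GeodesicStep (proj₁ x) (proj₁ y) 2 (weight (proj₁ x))
    s = swap-step (proj₁ x) (proj₁ y) (trans (proj₂ x) (sym (proj₂ y))) (n≢0⇒n>0 δ≢0)
    z : Slice N k
    z = point s , trans (weight-point s) (proj₂ x)
    δzy<δxy : δ z y < δ x y
    δzy<δxy = <-≤-trans (m<n+m (δ z y) {2} (s≤s z≤n)) (≤-reflexive (sym (dist-rest s)))
    regroup : ∀ a c d → 2 * c + (2 * a + c * d) ≡ 2 * a + c * (2 + d)
    regroup = solve-∀

  dist-E-bound : ∀ b b' x y → 2 * dist (E b x) (E b' y) ≤ 2 * f 0 + f 2 * δ x y
  dist-E-bound b b' x y = dist-E-bound-acc b b' x y (<-wellFounded (δ x y))

proposition4p5 : (D : ℕ → Set) → D 0 → (f : ℕ → ℕ) → (n k m : ℕ) → k ≤ n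
    → (E₁ E₂ : Slice (2 * n) k → Vec Bool m)
    → IsTwoPlayerCode (λ d → d ≡ 2 ⊎ D d) f E₁ E₂
    → (x y : Slice (2 * n) k)
    → 2 * (dist (E₁ x) (E₂ y) ⊔ dist (E₁ x) (E₁ y) ⊔ dist (E₂ x) (E₂ y))
      ≤ 4 * f 0 + f 2 * dist (proj₁ x) (proj₁ y)
proposition4p5 D d₀ f n k m _ E₁ E₂ code x y = begin
  2 * (d₁₂ ⊔ d₁₁ ⊔ d₂₂)           ≡⟨ *-distribˡ-⊔ 2 (d₁₂ ⊔ d₁₁) d₂₂ ⟩
  2 * (d₁₂ ⊔ d₁₁) ⊔ 2 * d₂₂       ≡⟨ cong (_⊔ 2 * d₂₂) (*-distribˡ-⊔ 2 d₁₂ d₁₁) ⟩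
  2 * d₁₂ ⊔ 2 * d₁₁ ⊔ 2 * d₂₂     ≤⟨ ⊔-lub (⊔-lub (dist-E-bound true false x y) (dist-E-bound true true x y))
                                            (dist-E-bound false false x y) ⟩
  2 * f 0 + f 2 * δ x y           ≤⟨ +-monoˡ-≤ (f 2 * δ x y) (*-monoˡ-≤ (f 0) {2} {4} (s≤s (s≤s z≤n))) ⟩
  4 * f 0 + f 2 * δ x y           ∎
  where
  open TwoPlayerCode {Dom = λ d → d ≡ 2 ⊎ D d} {f} {E₁} {E₂} code (inj₂ d₀) (inj₁ refl)
  open ≤-Reasoning
  d₁₂ d₁₁ d₂₂ : ℕ
  d₁₂ = dist (E₁ x) (E₂ y)
  d₁₁ = dist (E₁ x) (E₁ y)
  d₂₂ = dist (E₂ x) (E₂ y)
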